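{- Let $U$ be a coherent $P$-ultrafilter on $\mathbb{C}_\omega$ such that $U\cap\{a_i:i<\omega\}=\emptyset$. Then for every strictly increasing function $\varphi\colon\omega\to\omega$, the set $C_\varphi\cap U$ is cofinal in $U$, i.e. for every $u\in U$ there is $c\in C_\varphi\cap U$ with $c\le u$.
   Context: $\mathbb{C}_\omega$ is the Cohen algebra, the unique atomless complete Boolean algebra with a countable dense subalgebra. Fix an enumeration $\{d_k:k<\omega\}$ of a countable dense subalgebra with $d_0=\mathbb{0}$, and fix an infinite maximal antichain $\{a_i:i<\omega\}$ in $\mathbb{C}_\omega$. For a strictly increasing $\varphi\colon\omega\to\omega$, $C_\varphi\subseteq\mathbb{C}_\omega$ is the set of all $c$ for which there exists a strictly increasing sequence $\langle m_j:j<\omega\rangle$ such that for all $j<\omega$, $\{a_i\wedge c: i<\varphi(m_j)\}\subseteq\{d_k:k<\varphi(m_j)\}$. $\mathrm{Part}(\mathbb{C}_\omega)$ is the set of maximal antichains. An ultrafilter $U$ on a complete c.c.c. Boolean algebra $\mathbb{B}$ is a coherent $P$-ultrafilter if for every $P\in\mathrm{Part}(\mathbb{B})$ and every family $\{X_n:n<\omega\}$ of subsets of $P$ with $\bigvee X_n\in U$ for all $n$, there exists $Y\subseteq P$ such that $\bigvee Y\in U$ and $Y\setminus X_n$ is finite for all $n<\omega$. -}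

module Defs where

open import Level using (0ℓ)
open import Data.Nat using (ℕ; _<_)
open import Data.Product using (Σ; ∃; _×_; _,_)
open import Data.Sum using (_⊎_)
open import Data.List using (List)
open import Data.List.Relation.Unary.Any using (Any)
open import Relation.Nullary using (¬_)
open import Relation.Binary.PropositionalEquality using (_≡_)
open import Algebra.Lattice.Bundles using (BooleanAlgebra)

record CompleteBA : Set₁ where
  field
    ba : BooleanAlgebra 0ℓ 0ℓ
  open BooleanAlgebra ba public
  _≤_ : Carrier → Carrier → Set
  x ≤ y = (x ∧ y) ≈ x
  field
    ⋁       : (Carrier → Set) → Carrier
    ⋁-upper : (S : Carrier → Set) → ∀ x → S x → x ≤ ⋁ S
    ⋁-least : (S : Carrier → Set) → ∀ y → (∀ x → S x → x ≤ y) → ⋁ S ≤ y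

module _ (B : CompleteBA) where
  open CompleteBA B renaming (¬_ to compl)

  Subset : Set₁
  Subset = Carrier → Set

  _⊆_ : Subset → Subset → Set
  X ⊆ Y = ∀ x → X x → Y x

  Atomless : Set
  Atomless = ∀ x → ¬ (x ≈ ⊥) → ∃ λ y → (y ≤ x) × ¬ (y ≈ ⊥) × ¬ (y ≈ x)

  IsDenseSubalgebraEnum : (ℕ → Carrier) → Set
  IsDenseSubalgebraEnum d =
    (d 0 ≈ ⊥) ×
    (∀ i j → d i ≈ d j → i ≡ j) ×
    (∃ λ k → d k ≈ ⊤) ×
    (∀ i j → ∃ λ k → d k ≈ (d i ∧ d j)) ×
    (∀ i j → ∃ λ k → d k ≈ (d i ∨ d j)) ×
    (∀ i → ∃ λ k → d k ≈ (compl (d i))) ×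
    (∀ x → ¬ (x ≈ ⊥) → ∃ λ k → ¬ (d k ≈ ⊥) × (d k ≤ x))

  IsCohenAlgebra : Set
  IsCohenAlgebra = Atomless × ∃ λ d → IsDenseSubalgebraEnum d

  IsMaximalAntichain : Subset → Set
  IsMaximalAntichain P =
    (∀ x → P x → ¬ (x ≈ ⊥)) ×
    (∀ x y → P x → P y → ¬ (x ≈ y) → (x ∧ y) ≈ ⊥) ×
    (∀ x → ¬ (x ≈ ⊥) → ∃ λ p → P p × ¬ ((p ∧ x) ≈ ⊥))

  IsInfiniteMaximalAntichainSeq : (ℕ → Carrier) → Set
  IsInfiniteMaximalAntichainSeq a =
    (∀ i → ¬ (a i ≈ ⊥)) ×
    (∀ i j → ¬ (i ≡ j) → (a i ∧ a j) ≈ ⊥) ×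
    (∀ x → ¬ (x ≈ ⊥) → ∃ λ i → ¬ ((a i ∧ x) ≈ ⊥))

  IsUltrafilter : Subset → Set
  IsUltrafilter U =
    U ⊤ ×
    ¬ U ⊥ ×
    (∀ x y → U x → x ≤ y → U y) ×
    (∀ x y → U x → U y → U (x ∧ y)) ×
    (∀ x → U x ⊎ U (compl x))

  FiniteDiff : Subset → Subset → Set
  FiniteDiff Y X = ∃ λ (L : List Carrier) → ∀ y → Y y → ¬ X y → Any (y ≈_) L

  IsCoherentPUltrafilter : Subset → Set₁
  IsCoherentPUltrafilter U =
    IsUltrafilter U ×
    (∀ (P : Subset) → IsMaximalAntichain P →
      ∀ (X : ℕ → Subset) → (∀ n → X n ⊆ P) → (∀ n → U (⋁ (X n))) →
      ∃ λ (Y : Subset) → (Y ⊆ P) × U (⋁ Y) × (∀ n → FiniteDiff Y (X n)))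

  StrictlyIncreasing : (ℕ → ℕ) → Set
  StrictlyIncreasing f = ∀ i j → i < j → f i < f j

  C : (d a : ℕ → Carrier) → (φ : ℕ → ℕ) → Subset
  C d a φ c = ∃ λ (m : ℕ → ℕ) → StrictlyIncreasing m ×
    (∀ j i → i < φ (m j) → ∃ λ k → (k < φ (m j)) × ((a i ∧ c) ≈ d k))

{-# OPTIONS --safe #-}
-- Cover 𝟙 by the cells aᵢ ∧ u and ∁ u, and refine each cell greedily into a maximal antichain
-- of elements of the dense subalgebra. Coherence, applied to the sets of pieces meeting ∁ aᵢ
-- (whose joins lie in U because aᵢ ∉ U), yields Y with ⋁ Y ∈ U that contains only finitely
-- many pieces below each aᵢ; hence every aᵢ ∧ c₀, for c₀ = u ∧ ⋁ Y, is a finite join of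
-- pieces and so lies in the subalgebra. Choose stages mₜ so that the d-indices of the aᵢ ∧ c₀
-- with i < φ(mₜ) are below φ(mₜ₊₁), and cut c₀ down to zero on either the even or the odd
-- blocks [φ(mₜ), φ(mₜ₊₁)) of the antichain, whichever keeps it in U.
module Submission where

open import Defs
open import Level using (0ℓ)
open import Data.Nat as ℕ using (ℕ; zero; suc; _+_; _*_; _<_; _⊔_; z≤n; s≤s; _≤′_; ≤′-refl; ≤′-step)
open import Data.Product using (∃; _×_; _,_; proj₁; proj₂; map₂)
open import Data.Sum as Sum using (_⊎_; inj₁; inj₂)
open import Data.List using (List; []; _∷_)
open import Data.List.Relation.Unary.Any using (Any; here; there)
open import Relation.Nullary using (¬_; yes; no; contradiction)
open import Axiom.ExcludedMiddle using (ExcludedMiddle)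
import Relation.Binary.PropositionalEquality as ≡
open import Relation.Binary.Definitions using (tri<; tri≈; tri>)
import Relation.Binary.Lattice.Bundles as Order
import Relation.Binary.Lattice.Properties.MeetSemilattice as MeetProperties

module NatSequences where
  open import Data.Nat.Properties

  step-<⇒strictlyIncreasing : (f : ℕ → ℕ) → (∀ n → f n < f (suc n)) → ∀ i j → i < j → f i < f j
  step-<⇒strictlyIncreasing f f<f∘suc i j i<j = go (≤⇒≤′ i<j)
    where
    go : ∀ {j} → suc i ≤′ j → f i < f j
    go ≤′-refl = f<f∘suc i
    go (≤′-step i<j) = <-trans (go i<j) (f<f∘suc _)

  strictlyIncreasing⇒monotone : (f : ℕ → ℕ) → (∀ i j → i < j → f i < f j) →
    ∀ {i j} → i ℕ.≤ j → f i ℕ.≤ f j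
  strictlyIncreasing⇒monotone f f-inc i≤j with m≤n⇒m<n∨m≡n i≤j
  ... | inj₁ i<j = <⇒≤ (f-inc _ _ i<j)
  ... | inj₂ ≡.refl = ≤-refl

  strictlyIncreasing⇒inflationary : (f : ℕ → ℕ) → (∀ i j → i < j → f i < f j) → ∀ n → n ℕ.≤ f n
  strictlyIncreasing⇒inflationary f f-inc zero = z≤n
  strictlyIncreasing⇒inflationary f f-inc (suc n) =
    ≤-<-trans (strictlyIncreasing⇒inflationary f f-inc n) (f-inc n (suc n) (n<1+n n))

  bounded-on-prefix : (f : ℕ → ℕ) → ∀ n → ∃ λ M → ∀ i → i < n → f i < M
  bounded-on-prefix f zero = 0 , λ _ ()
  bounded-on-prefix f (suc n) with bounded-on-prefix f n
  ... | M , f<M = suc (f n) ⊔ M , bound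
    where
    bound : ∀ i → i < suc n → f i < suc (f n) ⊔ M
    bound i i<1+n with m<1+n⇒m<n∨m≡n i<1+n
    ... | inj₁ i<n = <-≤-trans (f<M i i<n) (m≤n⊔m (suc (f n)) M)
    ... | inj₂ ≡.refl = <-≤-trans (n<1+n (f i)) (m≤m⊔n (suc (f i)) M)

  block-unique : (ψ : ℕ → ℕ) → (∀ i j → i < j → ψ i < ψ j) → ∀ {s s' i} →
    ψ s ℕ.≤ i → i < ψ (suc s) → ψ s' ℕ.≤ i → i < ψ (suc s') → s ≡.≡ s'
  block-unique ψ ψ-inc {s} {s'} ψs≤i i<ψ1+s ψs'≤i i<ψ1+s' with <-cmp s s'
  ... | tri< s<s' _ _ = contradiction (≤-trans (strictlyIncreasing⇒monotone ψ ψ-inc s<s') ψs'≤i) (<⇒≱ i<ψ1+s)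
  ... | tri≈ _ s≡s' _ = s≡s'
  ... | tri> _ _ s'<s = contradiction (≤-trans (strictlyIncreasing⇒monotone ψ ψ-inc s'<s) ψs≤i) (<⇒≱ i<ψ1+s')

  stages : (φ : ℕ → ℕ) → (∀ i j → i < j → φ i < φ j) → (r : ℕ → ℕ) →
    ∃ λ m → (∀ i j → i < j → m i < m j) × (∀ t i → i < φ (m t) → r i < φ (m (suc t)))
  stages φ φ-inc r = m , step-<⇒strictlyIncreasing m m<m∘suc , r<φ∘m∘suc
    where
    m : ℕ → ℕ
    m zero = 0
    m (suc t) = suc (m t + proj₁ (bounded-on-prefix r (φ (m t))))

    m<m∘suc : ∀ t → m t < m (suc t)
    m<m∘suc t = s≤s (m≤m+n (m t) _)

    r<φ∘m∘suc : ∀ t i → i < φ (m t) → r i < φ (m (suc t))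
    r<φ∘m∘suc t i i<φmt = <-≤-trans (proj₂ (bounded-on-prefix r (φ (m t))) i i<φmt)
      (≤-trans (m≤n+m _ (m t)) (≤-trans (n≤1+n _) (strictlyIncreasing⇒inflationary φ φ-inc (m (suc t)))))

module BooleanOrder (B : CompleteBA) where
  open CompleteBA B public renaming (¬_ to ∁; ⊥ to 𝟘; ⊤ to 𝟙)
  open import Algebra.Lattice.Properties.BooleanAlgebra ba
    using (∨-∧-orderTheoreticLattice; ¬-involutive; ∧-zeroʳ; ∧-zeroˡ; ∧-identityʳ; ∨-identityˡ)
  -- Defs orders by x ∧ y ≈ x, the library's lattice order by x ≈ x ∧ y; lemmas transfer along sym.
  private
    module L = Order.Lattice ∨-∧-orderTheoreticLattice
    module M = MeetProperties L.meetSemilattice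

  ≤-reflexive : ∀ {x y} → x ≈ y → x ≤ y
  ≤-reflexive x≈y = sym (L.reflexive x≈y)

  ≤-refl : ∀ {x} → x ≤ x
  ≤-refl = ≤-reflexive refl

  ≤-trans : ∀ {x y z} → x ≤ y → y ≤ z → x ≤ z
  ≤-trans x≤y y≤z = sym (L.trans (sym x≤y) (sym y≤z))

  ≤-antisym : ∀ {x y} → x ≤ y → y ≤ x → x ≈ y
  ≤-antisym x≤y y≤x = L.antisym (sym x≤y) (sym y≤x)

  x∧y≤x : ∀ {x y} → (x ∧ y) ≤ x
  x∧y≤x = sym (L.x∧y≤x _ _)

  x∧y≤y : ∀ {x y} → (x ∧ y) ≤ y
  x∧y≤y = sym (L.x∧y≤y _ _)

  ∧-greatest : ∀ {x y z} → x ≤ y → x ≤ z → x ≤ (y ∧ z)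
  ∧-greatest x≤y x≤z = sym (L.∧-greatest (sym x≤y) (sym x≤z))

  x≤x∨y : ∀ {x y} → x ≤ (x ∨ y)
  x≤x∨y = sym (L.x≤x∨y _ _)

  y≤x∨y : ∀ {x y} → y ≤ (x ∨ y)
  y≤x∨y = sym (L.y≤x∨y _ _)

  ∨-least : ∀ {x y z} → x ≤ z → y ≤ z → (x ∨ y) ≤ z
  ∨-least x≤z y≤z = sym (L.∨-least (sym x≤z) (sym y≤z))

  ∧-mono : ∀ {x y x' y'} → x ≤ x' → y ≤ y' → (x ∧ y) ≤ (x' ∧ y')
  ∧-mono x≤x' y≤y' = sym (M.∧-monotonic (sym x≤x') (sym y≤y'))

  𝟘≤ : ∀ {x} → 𝟘 ≤ x
  𝟘≤ {x} = ∧-zeroˡ x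

  ≤𝟘⇒≈𝟘 : ∀ {x} → x ≤ 𝟘 → x ≈ 𝟘
  ≤𝟘⇒≈𝟘 {x} x≤𝟘 = trans (sym x≤𝟘) (∧-zeroʳ x)

  ≤-≈𝟘 : ∀ {x y} → x ≤ y → y ≈ 𝟘 → x ≈ 𝟘
  ≤-≈𝟘 x≤y y≈𝟘 = ≤𝟘⇒≈𝟘 (≤-trans x≤y (≤-reflexive y≈𝟘))

  x∧∁x≤𝟘 : ∀ {x} → (x ∧ ∁ x) ≤ 𝟘
  x∧∁x≤𝟘 {x} = ≤-reflexive (∧-complementʳ x)

  disjoint⇒≤∁ : ∀ {x y} → (x ∧ y) ≈ 𝟘 → x ≤ ∁ y
  disjoint⇒≤∁ {x} {y} x∧y≈𝟘 = begin
    x ∧ ∁ y                   ≈⟨ ∨-identityˡ _ ⟨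
    𝟘 ∨ (x ∧ ∁ y)             ≈⟨ ∨-congʳ x∧y≈𝟘 ⟨
    (x ∧ y) ∨ (x ∧ ∁ y)       ≈⟨ ∧-distribˡ-∨ x y (∁ y) ⟨
    x ∧ (y ∨ ∁ y)             ≈⟨ ∧-congˡ (∨-complementʳ y) ⟩
    x ∧ 𝟙                     ≈⟨ ∧-identityʳ x ⟩
    x                         ∎
    where open import Relation.Binary.Reasoning.Setoid setoid

  ≤∁⇒disjoint : ∀ {x y} → x ≤ ∁ y → (x ∧ y) ≈ 𝟘
  ≤∁⇒disjoint x≤∁y = ≤𝟘⇒≈𝟘 (≤-trans (∧-mono x≤∁y ≤-refl) (≤-trans (≤-reflexive (∧-comm _ _)) x∧∁x≤𝟘))

  ∧∁≈𝟘⇒≤ : ∀ {x y} → (x ∧ ∁ y) ≈ 𝟘 → x ≤ y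
  ∧∁≈𝟘⇒≤ {y = y} x∧∁y≈𝟘 = ≤-trans (disjoint⇒≤∁ x∧∁y≈𝟘) (≤-reflexive (¬-involutive y))

  ≤∁∨⇒∧≤ : ∀ {x y z} → y ≤ (∁ x ∨ z) → (x ∧ y) ≤ z
  ≤∁∨⇒∧≤ {x} {y} {z} y≤∁x∨z =
    ≤-trans (∧-mono ≤-refl y≤∁x∨z) (≤-trans (≤-reflexive x∧[∁x∨z]≈x∧z) x∧y≤y)
    where
    x∧[∁x∨z]≈x∧z : (x ∧ (∁ x ∨ z)) ≈ (x ∧ z)
    x∧[∁x∨z]≈x∧z = trans (∧-distribˡ-∨ x (∁ x) z) (trans (∨-congʳ (∧-complementʳ x)) (∨-identityˡ _))

  ∧-restrict-≤ : ∀ {x y f} → x ≤ f → (x ∧ (y ∧ f)) ≈ (x ∧ y)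
  ∧-restrict-≤ {x} {y} {f} x≤f = trans (sym (∧-assoc x y f)) (≤-trans x∧y≤x x≤f)

  ∧-restrict-disjoint : ∀ {x y f} → (x ∧ f) ≈ 𝟘 → (x ∧ (y ∧ f)) ≈ 𝟘
  ∧-restrict-disjoint x∧f≈𝟘 = ≤-≈𝟘 (∧-mono ≤-refl x∧y≤y) x∧f≈𝟘

  ≤⊎disjoint-∁ : ∀ {x f} → x ≤ f ⊎ (x ∧ f) ≈ 𝟘 → x ≤ ∁ f ⊎ (x ∧ ∁ f) ≈ 𝟘
  ≤⊎disjoint-∁ {f = f} (inj₁ x≤f) = inj₂ (≤-≈𝟘 (∧-mono x≤f ≤-refl) (∧-complementʳ f))
  ≤⊎disjoint-∁ (inj₂ x∧f≈𝟘) = inj₁ (disjoint⇒≤∁ x∧f≈𝟘)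

  ∨-disjoint : ∀ {x y z} → (x ∧ z) ≈ 𝟘 → (y ∧ z) ≈ 𝟘 → ((x ∨ y) ∧ z) ≈ 𝟘
  ∨-disjoint x∧z≈𝟘 y∧z≈𝟘 = ≤∁⇒disjoint (∨-least (disjoint⇒≤∁ x∧z≈𝟘) (disjoint⇒≤∁ y∧z≈𝟘))

  ⋁-mono : ∀ {S T : Carrier → Set} → (∀ x → S x → T x) → ⋁ S ≤ ⋁ T
  ⋁-mono {S} {T} S⊆T = ⋁-least S (⋁ T) (λ x Sx → ⋁-upper T x (S⊆T x Sx))

  ⋁-disjoint : ∀ (S : Carrier → Set) {y} → (∀ x → S x → (x ∧ y) ≈ 𝟘) → (y ∧ ⋁ S) ≈ 𝟘
  ⋁-disjoint S h = trans (∧-comm _ _) (≤∁⇒disjoint (⋁-least S _ (λ x Sx → disjoint⇒≤∁ (h x Sx))))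

  ∧-⋁-dichotomy : ∀ (Y : Carrier → Set) b → (∀ y → Y y → y ≤ b ⊎ (y ∧ b) ≈ 𝟘) →
    (b ∧ ⋁ Y) ≈ ⋁ (λ y → Y y × y ≤ b)
  ∧-⋁-dichotomy Y b dichotomy = ≤-antisym (≤∁∨⇒∧≤ (⋁-least Y _ bound)) (∧-greatest
    (⋁-least _ b (λ _ → proj₂)) (⋁-mono (λ _ → proj₁)))
    where
    bound : ∀ y → Y y → y ≤ (∁ b ∨ ⋁ (λ y → Y y × y ≤ b))
    bound y Yy with dichotomy y Yy
    ... | inj₁ y≤b = ≤-trans (⋁-upper _ y (Yy , y≤b)) y≤x∨y
    ... | inj₂ y∧b≈𝟘 = ≤-trans (disjoint⇒≤∁ y∧b≈𝟘) x≤x∨y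

module RangeAntichains (B : CompleteBA) (d : ℕ → CompleteBA.Carrier B) where
  open BooleanOrder B

  record MaximalAntichainBelow (t : Carrier) (G : ℕ → Set) : Set where
    field
      nonzero  : ∀ {k} → G k → ¬ d k ≈ 𝟘
      below    : ∀ {k} → G k → d k ≤ t
      disjoint : ∀ {k k'} → G k → G k' → k ≡.≢ k' → (d k ∧ d k') ≈ 𝟘
      maximal  : ∀ x → ¬ x ≈ 𝟘 → x ≤ t → ∃ λ k → G k × ¬ (d k ∧ x) ≈ 𝟘

  Pieces : {S : Set} → (S → ℕ → Set) → Carrier → Set
  Pieces G x = ∃ λ s → ∃ λ k → G s k × x ≡.≡ d k

module Classical (lem : ExcludedMiddle 0ℓ) (B : CompleteBA) where
  open BooleanOrder B
  open import Function using (_∘_)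

  Meeting : (Carrier → Set) → Carrier → Carrier → Set
  Meeting P z p = P p × ¬ (p ∧ z) ≈ 𝟘

  ≤-⋁-meeting : ∀ {P} → IsMaximalAntichain B P → ∀ z → z ≤ ⋁ (Meeting P z)
  ≤-⋁-meeting {P} (_ , _ , maximal) z with lem {(z ∧ ∁ (⋁ (Meeting P z))) ≈ 𝟘}
  ... | yes z∧∁V≈𝟘 = ∧∁≈𝟘⇒≤ z∧∁V≈𝟘
  ... | no z∧∁V≉𝟘 with maximal _ z∧∁V≉𝟘
  ...   | p , Pp , p∧z∧∁V≉𝟘 = contradiction (≤𝟘⇒≈𝟘 (≤-trans (∧-mono p≤V x∧y≤y) x∧∁x≤𝟘)) p∧z∧∁V≉𝟘
    where
    p≤V : p ≤ ⋁ (Meeting P z)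
    p≤V = ⋁-upper _ p (Pp , λ p∧z≈𝟘 → p∧z∧∁V≉𝟘 (≤-≈𝟘 (∧-mono ≤-refl x∧y≤x) p∧z≈𝟘))

  ⋁-split : ∀ (F : Carrier → Set) {l y₀} → F y₀ → y₀ ≈ l → ⋁ F ≈ (⋁ (λ y → F y × ¬ y ≈ l) ∨ y₀)
  ⋁-split F {l} {y₀} Fy₀ y₀≈l =
    ≤-antisym (⋁-least F _ bound) (∨-least (⋁-mono (λ _ → proj₁)) (⋁-upper F y₀ Fy₀))
    where
    bound : ∀ y → F y → y ≤ (⋁ (λ y → F y × ¬ y ≈ l) ∨ y₀)
    bound y Fy with lem {y ≈ l}
    ... | yes y≈l = ≤-trans (≤-reflexive (trans y≈l (sym y₀≈l))) y≤x∨y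
    ... | no y≉l = ≤-trans (⋁-upper _ y (Fy , y≉l)) x≤x∨y

  module _ (d : ℕ → Carrier) (d0≈𝟘 : d 0 ≈ 𝟘) (d-∨ : ∀ i j → ∃ λ k → d k ≈ (d i ∨ d j)) where

    ⋁-finite-∈-range : ∀ (L : List Carrier) (F : Carrier → Set) → (∀ y → F y → Any (y ≈_) L) →
      (∀ y → F y → ∃ λ k → y ≈ d k) → ∃ λ k → ⋁ F ≈ d k
    ⋁-finite-∈-range [] F F⊆[] _ =
      0 , ≤-antisym (⋁-least F _ (λ y Fy → contradiction (F⊆[] y Fy) λ ())) (≤-trans (≤-reflexive d0≈𝟘) 𝟘≤)
    ⋁-finite-∈-range (l ∷ L) F F⊆l∷L F⊆d
      with ⋁-finite-∈-range L (λ y → F y × ¬ y ≈ l) F∖l⊆L (λ y → F⊆d y ∘ proj₁)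
      where
      F∖l⊆L : ∀ y → F y × ¬ y ≈ l → Any (y ≈_) L
      F∖l⊆L y (Fy , y≉l) with F⊆l∷L y Fy
      ... | here y≈l = contradiction y≈l y≉l
      ... | there y∈L = y∈L
    ... | k , ⋁F∖l≈dk with lem {∃ λ y → F y × y ≈ l}
    ...   | no l∉F = k , trans ⋁F≈⋁F∖l ⋁F∖l≈dk
      where
      ⋁F≈⋁F∖l : ⋁ F ≈ ⋁ (λ y → F y × ¬ y ≈ l)
      ⋁F≈⋁F∖l = ≤-antisym (⋁-mono (λ y Fy → Fy , λ y≈l → l∉F (y , Fy , y≈l))) (⋁-mono (λ _ → proj₁))
    ...   | yes (y₀ , Fy₀ , y₀≈l) with F⊆d y₀ Fy₀
    ...     | k₀ , y₀≈dk₀ with d-∨ k k₀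
    ...       | k' , dk'≈dk∨dk₀ =
      k' , trans (⋁-split F Fy₀ y₀≈l) (trans (∨-cong ⋁F∖l≈dk y₀≈dk₀) (sym dk'≈dk∨dk₀))

  module Greedy (d : ℕ → Carrier) (dense : ∀ x → ¬ x ≈ 𝟘 → ∃ λ k → ¬ d k ≈ 𝟘 × d k ≤ x)
    (t : Carrier) where
    open RangeAntichains B d
    open import Data.Nat.Properties using (≤⇒≤′; <-cmp)

    mutual
      chosenBelow : ℕ → Carrier
      chosenBelow zero = 𝟘
      chosenBelow (suc k) with lem {Chosen k}
      ... | yes _ = chosenBelow k ∨ d k
      ... | no _ = chosenBelow k

      Chosen : ℕ → Set
      Chosen k = ¬ d k ≈ 𝟘 × d k ≤ t × (d k ∧ chosenBelow k) ≈ 𝟘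

    chosenBelow-step : ∀ k → chosenBelow k ≤ chosenBelow (suc k)
    chosenBelow-step k with lem {Chosen k}
    ... | yes _ = x≤x∨y
    ... | no _ = ≤-refl

    chosenBelow-mono : ∀ {k k'} → k ≤′ k' → chosenBelow k ≤ chosenBelow k'
    chosenBelow-mono ≤′-refl = ≤-refl
    chosenBelow-mono (≤′-step k≤k') = ≤-trans (chosenBelow-mono k≤k') (chosenBelow-step _)

    chosen≤chosenBelow : ∀ {k} → Chosen k → d k ≤ chosenBelow (suc k)
    chosen≤chosenBelow {k} chosen with lem {Chosen k}
    ... | yes _ = y≤x∨y
    ... | no not-chosen = contradiction chosen not-chosen

    chosen-disjoint : ∀ {k k'} → Chosen k → Chosen k' → k < k' → (d k ∧ d k') ≈ 𝟘
    chosen-disjoint chosen (_ , _ , dk'∧below≈𝟘) k<k' = ≤𝟘⇒≈𝟘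
      (≤-trans (∧-mono (≤-trans (chosen≤chosenBelow chosen) (chosenBelow-mono (≤⇒≤′ k<k'))) ≤-refl)
               (≤-trans (≤-reflexive (∧-comm _ _)) (≤-reflexive dk'∧below≈𝟘)))

    meets-chosen : ∀ k y → ¬ (chosenBelow k ∧ y) ≈ 𝟘 → ∃ λ k' → Chosen k' × ¬ (d k' ∧ y) ≈ 𝟘
    meets-chosen zero y 𝟘∧y≉𝟘 = contradiction 𝟘≤ 𝟘∧y≉𝟘
    meets-chosen (suc k) y below∧y≉𝟘 with lem {Chosen k}
    ... | no _ = meets-chosen k y below∧y≉𝟘
    ... | yes chosen with lem {(d k ∧ y) ≈ 𝟘}
    ...   | no dk∧y≉𝟘 = k , chosen , dk∧y≉𝟘
    ...   | yes dk∧y≈𝟘 = meets-chosen k y λ below∧y≈𝟘 → below∧y≉𝟘 (∨-disjoint below∧y≈𝟘 dk∧y≈𝟘)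

    maximalAntichainBelow : MaximalAntichainBelow t Chosen
    maximalAntichainBelow = record
      { nonzero  = proj₁
      ; below    = λ chosen → proj₁ (proj₂ chosen)
      ; disjoint = disjoint
      ; maximal  = maximal
      }
      where
      disjoint : ∀ {k k'} → Chosen k → Chosen k' → k ≡.≢ k' → (d k ∧ d k') ≈ 𝟘
      disjoint {k} {k'} chosen chosen' k≢k' with <-cmp k k'
      ... | tri< k<k' _ _ = chosen-disjoint chosen chosen' k<k'
      ... | tri≈ _ k≡k' _ = contradiction k≡k' k≢k'
      ... | tri> _ _ k'<k = trans (∧-comm _ _) (chosen-disjoint chosen' chosen k'<k)

      maximal : ∀ x → ¬ x ≈ 𝟘 → x ≤ t → ∃ λ k → Chosen k × ¬ (d k ∧ x) ≈ 𝟘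
      maximal x x≉𝟘 x≤t with dense x x≉𝟘
      ... | k , dk≉𝟘 , dk≤x with lem {Chosen k}
      ...   | yes chosen = k , chosen , λ dk∧x≈𝟘 → dk≉𝟘 (trans (sym dk≤x) dk∧x≈𝟘)
      ...   | no not-chosen with lem {(d k ∧ chosenBelow k) ≈ 𝟘}
      ...     | yes dk∧below≈𝟘 = contradiction (dk≉𝟘 , ≤-trans dk≤x x≤t , dk∧below≈𝟘) not-chosen
      ...     | no dk∧below≉𝟘
        with meets-chosen k (d k) (λ below∧dk≈𝟘 → dk∧below≉𝟘 (trans (∧-comm _ _) below∧dk≈𝟘))
      ...       | k' , chosen' , dk'∧dk≉𝟘 =
        k' , chosen' , λ dk'∧x≈𝟘 → dk'∧dk≉𝟘 (≤-≈𝟘 (∧-mono ≤-refl dk≤x) dk'∧x≈𝟘)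

  module Refinement {S : Set} (d : ℕ → Carrier) (t : S → Carrier) (G : S → ℕ → Set)
    (t-disjoint : ∀ s s' → s ≡.≢ s' → (t s ∧ t s') ≈ 𝟘)
    (G-antichain : ∀ s → RangeAntichains.MaximalAntichainBelow B d (t s) (G s)) where
    open RangeAntichains B d
    open module G-antichain s = MaximalAntichainBelow (G-antichain s)

    piece-dichotomy : ∀ {p} → Pieces G p → ∀ s → p ≤ t s ⊎ (p ∧ t s) ≈ 𝟘
    piece-dichotomy (s' , k , Gs'k , ≡.refl) s with lem {s' ≡.≡ s}
    ... | yes ≡.refl = inj₁ (below s Gs'k)
    ... | no s'≢s = inj₂ (≤-≈𝟘 (∧-mono (below s' Gs'k) ≤-refl) (t-disjoint s' s s'≢s))

    pieces-isMaximalAntichain : (∀ x → ¬ x ≈ 𝟘 → ∃ λ s → ¬ (t s ∧ x) ≈ 𝟘) →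
      IsMaximalAntichain B (Pieces G)
    pieces-isMaximalAntichain t-covers = nonzero′ , disjoint′ , maximal′
      where
      nonzero′ : ∀ x → Pieces G x → ¬ x ≈ 𝟘
      nonzero′ _ (s , k , Gsk , ≡.refl) = nonzero s Gsk

      disjoint′ : ∀ x y → Pieces G x → Pieces G y → ¬ x ≈ y → (x ∧ y) ≈ 𝟘
      disjoint′ _ _ (s , k , Gsk , ≡.refl) (s' , k' , Gs'k' , ≡.refl) dk≉dk' with lem {s ≡.≡ s'}
      ... | yes ≡.refl = disjoint s Gsk Gs'k' λ { ≡.refl → dk≉dk' refl }
      ... | no s≢s' = ≤-≈𝟘 (∧-mono (below s Gsk) (below s' Gs'k')) (t-disjoint s s' s≢s')

      maximal′ : ∀ x → ¬ x ≈ 𝟘 → ∃ λ p → Pieces G p × ¬ (p ∧ x) ≈ 𝟘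
      maximal′ x x≉𝟘 with t-covers x x≉𝟘
      ... | s , ts∧x≉𝟘 with maximal s (t s ∧ x) ts∧x≉𝟘 x∧y≤x
      ...   | k , Gsk , dk∧ts∧x≉𝟘 =
        d k , (s , k , Gsk , ≡.refl) , λ dk∧x≈𝟘 → dk∧ts∧x≉𝟘 (≤-≈𝟘 (∧-mono ≤-refl x∧y≤y) dk∧x≈𝟘)


  module EvenOddSplit (d : ℕ → Carrier) (d0≈𝟘 : d 0 ≈ 𝟘)
    (a : ℕ → Carrier) (a-disjoint : ∀ i j → i ≡.≢ j → (a i ∧ a j) ≈ 𝟘)
    (φ : ℕ → ℕ) (φ-inc : StrictlyIncreasing B φ)
    (c₀ : Carrier) (row : ∀ i → ∃ λ k → (a i ∧ c₀) ≈ d k) where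
    open NatSequences
    open import Data.Nat.Properties using (≤-<-trans; ≰⇒>; n<1+n; *-monoʳ-<; even≢odd)

    rowCode : ℕ → ℕ
    rowCode i = proj₁ (row i)

    stage : ℕ → ℕ
    stage = proj₁ (stages φ φ-inc rowCode)

    ψ : ℕ → ℕ
    ψ t = φ (stage t)

    stage-inc : ∀ i j → i < j → stage i < stage j
    stage-inc = proj₁ (proj₂ (stages φ φ-inc rowCode))

    ψ-inc : ∀ i j → i < j → ψ i < ψ j
    ψ-inc i j i<j = φ-inc _ _ (stage-inc i j i<j)

    rowCode<ψ∘suc : ∀ t i → i < ψ t → rowCode i < ψ (suc t)
    rowCode<ψ∘suc = proj₂ (proj₂ (stages φ φ-inc rowCode))

    ∈C-of-vanishing-blocks : ∀ c → (∀ i → (a i ∧ c) ≈ (a i ∧ c₀) ⊎ (a i ∧ c) ≈ 𝟘) →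
      (b : ℕ → ℕ) → (∀ j → b j < b (suc j)) →
      (∀ j i → ψ (b j) ℕ.≤ i → i < ψ (suc (b j)) → (a i ∧ c) ≈ 𝟘) → C B d a φ c
    ∈C-of-vanishing-blocks c dichotomy b b-step vanishes =
      (λ j → stage (suc (b j))) , stage∘suc∘b-inc , entry
      where
      stage∘suc∘b-inc : ∀ i j → i < j → stage (suc (b i)) < stage (suc (b j))
      stage∘suc∘b-inc i j i<j = stage-inc _ _ (s≤s (step-<⇒strictlyIncreasing b b-step i j i<j))

      zero-entry : ∀ {i n} → (a i ∧ c) ≈ 𝟘 → i < n → ∃ λ k → k < n × (a i ∧ c) ≈ d k
      zero-entry ai∧c≈𝟘 i<n = 0 , ≤-<-trans z≤n i<n , trans ai∧c≈𝟘 (sym d0≈𝟘)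

      entry : ∀ j i → i < ψ (suc (b j)) → ∃ λ k → k < ψ (suc (b j)) × (a i ∧ c) ≈ d k
      entry j i i<ψ with dichotomy i | ψ (b j) ℕ.≤? i
      ... | inj₂ ai∧c≈𝟘 | _ = zero-entry ai∧c≈𝟘 i<ψ
      ... | inj₁ _ | yes ψ≤i = zero-entry (vanishes j i ψ≤i i<ψ) i<ψ
      ... | inj₁ ai∧c≈ai∧c₀ | no ψ≰i =
        rowCode i , rowCode<ψ∘suc (b j) i (≰⇒> ψ≰i) , trans ai∧c≈ai∧c₀ (proj₂ (row i))

    InEvenBlock : ℕ → Set
    InEvenBlock i = ∃ λ r → ψ (2 * r) ℕ.≤ i × i < ψ (suc (2 * r))

    ⋁a : (ℕ → Set) → Carrier
    ⋁a E = ⋁ (λ x → ∃ λ i → E i × x ≡.≡ a i)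

    a≤⋁a : ∀ {E i} → E i → a i ≤ ⋁a E
    a≤⋁a {i = i} Ei = ⋁-upper _ (a i) (i , Ei , ≡.refl)

    a∧⋁a≈𝟘 : ∀ {E i} → ¬ E i → (a i ∧ ⋁a E) ≈ 𝟘
    a∧⋁a≈𝟘 {i = i} ¬Ei = ⋁-disjoint _ λ { _ (j , Ej , ≡.refl) → a-disjoint j i λ { ≡.refl → ¬Ei Ej } }

    a-vs-⋁a : ∀ E i → a i ≤ ⋁a E ⊎ (a i ∧ ⋁a E) ≈ 𝟘
    a-vs-⋁a E i with lem {E i}
    ... | yes Ei = inj₁ (a≤⋁a Ei)
    ... | no ¬Ei = inj₂ (a∧⋁a≈𝟘 ¬Ei)

    e : Carrier
    e = ⋁a InEvenBlock

    c₀∧e∈C : C B d a φ (c₀ ∧ e)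
    c₀∧e∈C = ∈C-of-vanishing-blocks (c₀ ∧ e)
      (λ i → Sum.map ∧-restrict-≤ ∧-restrict-disjoint (a-vs-⋁a InEvenBlock i))
      (λ j → suc (2 * j)) (λ j → s≤s (*-monoʳ-< 2 (n<1+n j)))
      λ j i ψ≤i i<ψ → ∧-restrict-disjoint (a∧⋁a≈𝟘 λ (r , ψ≤′i , i<ψ′) →
        even≢odd r j (block-unique ψ ψ-inc ψ≤′i i<ψ′ ψ≤i i<ψ))

    c₀∧∁e∈C : C B d a φ (c₀ ∧ ∁ e)
    c₀∧∁e∈C = ∈C-of-vanishing-blocks (c₀ ∧ ∁ e)
      (λ i → Sum.map ∧-restrict-≤ ∧-restrict-disjoint (≤⊎disjoint-∁ (a-vs-⋁a InEvenBlock i)))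
      (λ j → 2 * suc j) (λ j → *-monoʳ-< 2 (n<1+n (suc j)))
      λ j i ψ≤i i<ψ → ∧-restrict-disjoint (≤-≈𝟘 (∧-mono (a≤⋁a (suc j , ψ≤i , i<ψ)) ≤-refl) (∧-complementʳ e))

module Cofinality (lem : ExcludedMiddle 0ℓ) (B : CompleteBA)
  (d : ℕ → CompleteBA.Carrier B) (d-subalgebra : IsDenseSubalgebraEnum B d)
  (a : ℕ → CompleteBA.Carrier B) (a-antichain : IsInfiniteMaximalAntichainSeq B a)
  (U : CompleteBA.Carrier B → Set) (U-coherent : IsCoherentPUltrafilter B U)
  (a∉U : ∀ i → ¬ U (a i))
  (φ : ℕ → ℕ) (φ-inc : StrictlyIncreasing B φ)
  (u : CompleteBA.Carrier B) (u∈U : U u) where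
  open BooleanOrder B public
  open Classical lem B
  open RangeAntichains B d
  open import Data.Maybe using (Maybe; just; nothing)

  d0≈𝟘 : d 0 ≈ 𝟘
  d0≈𝟘 = proj₁ d-subalgebra

  d-∨ : ∀ i j → ∃ λ k → d k ≈ (d i ∨ d j)
  d-∨ = proj₁ (proj₂ (proj₂ (proj₂ (proj₂ d-subalgebra))))

  d-dense : ∀ x → ¬ x ≈ 𝟘 → ∃ λ k → ¬ d k ≈ 𝟘 × d k ≤ x
  d-dense = proj₂ (proj₂ (proj₂ (proj₂ (proj₂ (proj₂ d-subalgebra)))))

  a-disjoint : ∀ i j → i ≡.≢ j → (a i ∧ a j) ≈ 𝟘
  a-disjoint = proj₁ (proj₂ a-antichain)

  a-covers : ∀ x → ¬ x ≈ 𝟘 → ∃ λ i → ¬ (a i ∧ x) ≈ 𝟘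
  a-covers = proj₂ (proj₂ a-antichain)

  U-up : ∀ {x y} → U x → x ≤ y → U y
  U-up = proj₁ (proj₂ (proj₂ (proj₁ U-coherent))) _ _

  U-∧ : ∀ {x y} → U x → U y → U (x ∧ y)
  U-∧ = proj₁ (proj₂ (proj₂ (proj₂ (proj₁ U-coherent)))) _ _

  U-dichotomy : ∀ x → U x ⊎ U (∁ x)
  U-dichotomy = proj₂ (proj₂ (proj₂ (proj₂ (proj₁ U-coherent))))

  ∁a∈U : ∀ i → U (∁ (a i))
  ∁a∈U i with U-dichotomy (a i)
  ... | inj₁ ai∈U = contradiction ai∈U (a∉U i)
  ... | inj₂ ∁ai∈U = ∁ai∈U

  cell : Maybe ℕ → Carrier
  cell (just i) = a i ∧ u
  cell nothing = ∁ u

  cell-disjoint : ∀ s s' → s ≡.≢ s' → (cell s ∧ cell s') ≈ 𝟘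
  cell-disjoint (just i) (just j) s≢s' =
    ≤-≈𝟘 (∧-mono x∧y≤x x∧y≤x) (a-disjoint i j λ i≡j → s≢s' (≡.cong just i≡j))
  cell-disjoint (just i) nothing _ = ≤-≈𝟘 (∧-mono x∧y≤y ≤-refl) (∧-complementʳ u)
  cell-disjoint nothing (just j) _ = ≤-≈𝟘 (∧-mono ≤-refl x∧y≤y) (∧-complementˡ u)
  cell-disjoint nothing nothing s≢s' = contradiction ≡.refl s≢s'

  cell-covers : ∀ x → ¬ x ≈ 𝟘 → ∃ λ s → ¬ (cell s ∧ x) ≈ 𝟘
  cell-covers x x≉𝟘 with lem {(x ∧ ∁ u) ≈ 𝟘}
  ... | no x∧∁u≉𝟘 = nothing , λ ∁u∧x≈𝟘 → x∧∁u≉𝟘 (trans (∧-comm x (∁ u)) ∁u∧x≈𝟘)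
  ... | yes x∧∁u≈𝟘 with a-covers x x≉𝟘
  ...   | i , ai∧x≉𝟘 = just i , λ ai∧u∧x≈𝟘 → ai∧x≉𝟘 (≤-≈𝟘 ai∧x≤ai∧u∧x ai∧u∧x≈𝟘)
    where
    ai∧x≤ai∧u∧x : (a i ∧ x) ≤ ((a i ∧ u) ∧ x)
    ai∧x≤ai∧u∧x = ∧-greatest (∧-greatest x∧y≤x (≤-trans x∧y≤y (∧∁≈𝟘⇒≤ x∧∁u≈𝟘))) x∧y≤y

  module CellAntichain (s : Maybe ℕ) = Greedy d d-dense (cell s)
  open Refinement d cell CellAntichain.Chosen cell-disjoint CellAntichain.maximalAntichainBelow

  Piece : Carrier → Set
  Piece = Pieces CellAntichain.Chosen

  piece-isMaximalAntichain : IsMaximalAntichain B Piece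
  piece-isMaximalAntichain = pieces-isMaximalAntichain cell-covers

  ⋁-meeting-∁a∈U : ∀ n → U (⋁ (Meeting Piece (∁ (a n))))
  ⋁-meeting-∁a∈U n = U-up (∁a∈U n) (≤-⋁-meeting piece-isMaximalAntichain (∁ (a n)))

  coherent-refinement : ∃ λ Y → (∀ y → Y y → Piece y) × U (⋁ Y) ×
    (∀ n → FiniteDiff B Y (Meeting Piece (∁ (a n))))
  coherent-refinement = proj₂ U-coherent Piece piece-isMaximalAntichain _ (λ _ _ → proj₁) ⋁-meeting-∁a∈U

  Y : Carrier → Set
  Y = proj₁ coherent-refinement

  Y⊆Piece : ∀ y → Y y → Piece y
  Y⊆Piece = proj₁ (proj₂ coherent-refinement)

  Y-finite : ∀ n → FiniteDiff B Y (Meeting Piece (∁ (a n)))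
  Y-finite = proj₂ (proj₂ (proj₂ coherent-refinement))

  c₀ : Carrier
  c₀ = u ∧ ⋁ Y

  c₀∈U : U c₀
  c₀∈U = U-∧ u∈U (proj₁ (proj₂ (proj₂ coherent-refinement)))

  YBelow : ℕ → Carrier → Set
  YBelow i y = Y y × y ≤ cell (just i)

  a∧c₀≈⋁YBelow : ∀ i → (a i ∧ c₀) ≈ ⋁ (YBelow i)
  a∧c₀≈⋁YBelow i = trans (sym (∧-assoc (a i) u (⋁ Y)))
    (∧-⋁-dichotomy Y (cell (just i)) λ y Yy → piece-dichotomy (Y⊆Piece y Yy) (just i))

  YBelow-finite : ∀ i y → YBelow i y → Any (y ≈_) (proj₁ (Y-finite i))
  YBelow-finite i y (Yy , y≤ai∧u) = proj₂ (Y-finite i) y Yy λ (_ , y∧∁ai≉𝟘) →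
    y∧∁ai≉𝟘 (≤-≈𝟘 (∧-mono (≤-trans y≤ai∧u x∧y≤x) ≤-refl) (∧-complementʳ (a i)))

  YBelow-∈-range : ∀ i y → YBelow i y → ∃ λ k → y ≈ d k
  YBelow-∈-range i y (Yy , _) with Y⊆Piece y Yy
  ... | _ , k , _ , ≡.refl = k , refl

  row : ∀ i → ∃ λ k → (a i ∧ c₀) ≈ d k
  row i = map₂ (trans (a∧c₀≈⋁YBelow i))
    (⋁-finite-∈-range d d0≈𝟘 d-∨ (proj₁ (Y-finite i)) (YBelow i) (YBelow-finite i) (YBelow-∈-range i))

  open EvenOddSplit d d0≈𝟘 a a-disjoint φ φ-inc c₀ row public

  witness : ∀ f → C B d a φ (c₀ ∧ f) → U f → ∃ λ c → C B d a φ c × U c × c ≤ u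
  witness f c₀∧f∈C f∈U = c₀ ∧ f , c₀∧f∈C , U-∧ c₀∈U f∈U , ≤-trans x∧y≤x x∧y≤x

lemma5p4 : ExcludedMiddle 0ℓ →
    (B : CompleteBA) → Atomless B →
    (d : ℕ → CompleteBA.Carrier B) → IsDenseSubalgebraEnum B d →
    (a : ℕ → CompleteBA.Carrier B) → IsInfiniteMaximalAntichainSeq B a →
    (U : CompleteBA.Carrier B → Set) → IsCoherentPUltrafilter B U →
    (∀ i → ¬ U (a i)) →
    (φ : ℕ → ℕ) → StrictlyIncreasing B φ →
    ∀ u → U u → ∃ λ c → C B d a φ c × U c × CompleteBA._≤_ B c u
lemma5p4 lem B _ d d-subalgebra a a-antichain U U-coherent a∉U φ φ-inc u u∈U =
  Sum.[ witness e c₀∧e∈C , witness (∁ e) c₀∧∁e∈C ] (U-dichotomy e)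
  where open Cofinality lem B d d-subalgebra a a-antichain U U-coherent a∉U φ φ-inc u u∈U
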